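{- Let $G$ be a partially ordered group with identity $e$ and positive cone $G^+ = \{x \in G : x > e\}$. Let $H^+$ be the set of all atoms of $G^+$, i.e. the elements $x \in G^+$ such that there is no $y \in G$ with $e < y < x$. Let $\mathcal{J}$ be a set of nonempty finite subsets of $G^+$ such that the open interval $(e,x) = \{y\in G: e<y<x\}$ belongs to $\mathcal{J}$ for every $x \in G^+ \setminus H^+$. For $A \subseteq G$ let $\sigma_{\mathcal{J}}(A) = \inf\{ |A\cap J|/|J| : J \in \mathcal{J}\}$. Let $A$ and $B$ be subsets of $G^+$ with $H^+ \subseteq A \cup B$. If $\sigma_{\mathcal{J}}(A) + \sigma_{\mathcal{J}}(B) > 1$, then $AB = G^+ \cup \{e\}$, where $AB = \{ab : a \in A\cup\{e\},\ b \in B \cup \{e\}\}$.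
   Context: A partially ordered group is a group $G$ with a partial order $\le$ such that $a \le b$ implies $ac \le bc$ and $ca \le cb$ for all $a,b,c \in G$. We write $x<y$ if $x \le y$ and $x \ne y$. -}

module Defs where

open import Level using (0ℓ)
open import Data.Nat using (ℕ; _*_; _+_; _≤_; _<_)
open import Data.Product using (Σ; ∃; _×_; _,_)
open import Data.Sum using (_⊎_)
open import Data.List using (List; length)
open import Data.List.Relation.Unary.All using (All)
open import Data.List.Relation.Unary.Unique.Propositional using (Unique)
open import Data.List.Relation.Binary.Sublist.Propositional using (_⊆_)
open import Data.List.Membership.Propositional using (_∈_)
open import Relation.Nullary using (¬_)
open import Relation.Unary using (Pred)
open import Relation.Binary.PropositionalEquality using (_≡_; _≢_)
open import Relation.Binary using (Rel; IsPartialOrder)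
open import Algebra.Structures using (IsGroup)

record POGroup : Set₁ where
  field
    Carrier : Set
    _∙_     : Carrier → Carrier → Carrier
    e       : Carrier
    _⁻¹     : Carrier → Carrier
    _≤ᴳ_    : Rel Carrier 0ℓ
    isGroup        : IsGroup _≡_ _∙_ e _⁻¹
    isPartialOrder : IsPartialOrder _≡_ _≤ᴳ_
    compatʳ : ∀ {a b} c → a ≤ᴳ b → (a ∙ c) ≤ᴳ (b ∙ c)
    compatˡ : ∀ {a b} c → a ≤ᴳ b → (c ∙ a) ≤ᴳ (c ∙ b)

  infix 4 _<ᴳ_
  _<ᴳ_ : Rel Carrier 0ℓ
  x <ᴳ y = x ≤ᴳ y × x ≢ y

  Pos : Pred Carrier 0ℓ
  Pos x = e <ᴳ x

  Atom : Pred Carrier 0ℓ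
  Atom x = e <ᴳ x × ¬ (Σ Carrier λ y → e <ᴳ y × y <ᴳ x)

  -- |A ∩ J| ≥ k, for a finite set J given as a duplicate-free list:
  -- some sub-list of J of length ≥ k lies entirely in A.
  CardInterAtLeast : Pred Carrier 0ℓ → List Carrier → ℕ → Set
  CardInterAtLeast A J k = Σ (List Carrier) λ S → S ⊆ J × All A S × k ≤ length S

  -- "σ_𝒥(A) ≥ a / d": for every J in the family,  |A ∩ J| / |J| ≥ a / d,
  -- i.e. a·|J| ≤ d·|A ∩ J|.
  σ≥ : {I : Set} → (I → List Carrier) → Pred Carrier 0ℓ → ℕ → ℕ → Set
  σ≥ {I} 𝒥 A a d = (i : I) → Σ ℕ λ k → CardInterAtLeast A (𝒥 i) k × a * length (𝒥 i) ≤ d * k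

  -- "σ_𝒥(A) + σ_𝒥(B) > 1": there are rationals a/d ≤ σ_𝒥(A), b/d ≤ σ_𝒥(B)
  -- (d > 0) with a/d + b/d > 1.
  σSumGt1 : {I : Set} → (I → List Carrier) → Pred Carrier 0ℓ → Pred Carrier 0ℓ → Set
  σSumGt1 𝒥 A B = Σ ℕ λ a → Σ ℕ λ b → Σ ℕ λ d →
    0 < d × d < a + b × σ≥ 𝒥 A a d × σ≥ 𝒥 B b d

  Prod : Pred Carrier 0ℓ → Pred Carrier 0ℓ → Pred Carrier 0ℓ
  Prod A B x = Σ Carrier λ a → Σ Carrier λ b →
    (A a ⊎ a ≡ e) × (B b ⊎ b ≡ e) × x ≡ a ∙ b

  record Admissible {I : Set} (𝒥 : I → List Carrier) : Set where
    field
      unique   : ∀ i → Unique (𝒥 i)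
      nonempty : ∀ i → 0 < length (𝒥 i)
      positive : ∀ i → All Pos (𝒥 i)
      intervals : ∀ x → Pos x → ¬ Atom x →
        Σ I λ i → ∀ y → (y ∈ 𝒥 i → e <ᴳ y × y <ᴳ x) × (e <ᴳ y × y <ᴳ x → y ∈ 𝒥 i)

{-# OPTIONS --safe #-}
module Submission where

-- If x > e is not an atom, J = (e,x) lies in 𝒥 and the density bound gives
-- |A ∩ J| + |B ∩ J| > |J|.  Both a ↦ a and b ↦ x b⁻¹ map into J injectively
-- (e < b < x implies e < x b⁻¹ < x), so by pigeonhole some a = x b⁻¹, i.e. x = ab.
-- Atoms lie in A ∪ B.  Constructively one must also decide whether x is an atom:
-- x is not one iff x = yz with y, z > e, and such factors lie in the finite
-- duplicate-free list (e,x²) ∈ 𝒥; equality of y, z > e is decidable for the same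
-- reason, as both lie in (e,yz).

open import Defs
open import Level using (0ℓ)
open import Algebra.Bundles using (Group)
import Algebra.Properties.Group as GroupProperties
open import Data.Empty using (⊥-elim)
open import Data.Fin using (Fin; zero; suc; splitAt)
open import Data.Fin.Properties using (pigeonhole; any?; +↔⊎; <⇒≢) renaming (_≟_ to _≟ᶠ_)
open import Data.List using (List; _∷_; length; lookup; map)
open import Data.List.Properties using (length-map)
open import Data.List.Relation.Unary.All as All using (All)
open import Data.List.Relation.Unary.Any using (index)
open import Data.List.Relation.Unary.Any.Properties using (lookup-index)
open import Data.List.Relation.Unary.Unique.Propositional using (Unique; []; _∷_)
import Data.List.Relation.Unary.Unique.Propositional.Properties as Unique
import Data.List.Relation.Binary.Sublist.Propositional as Sublist
open import Data.List.Relation.Binary.Sublist.Propositional.Properties using (All-resp-⊆)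
open import Data.List.Relation.Binary.Subset.Propositional using (_⊆_)
open import Data.List.Membership.Propositional using (_∈_)
open import Data.List.Membership.Propositional.Properties using (∈-lookup; ∈-map⁻)
open import Data.List.Membership.Setoid.Properties using (index-injective)
open import Data.Nat using (_+_; _*_; _≤_; _<_; >-nonZero)
open import Data.Nat.Properties using (≤-trans; *-monoʳ-≤; *-monoˡ-<; *-cancelˡ-<; +-mono-≤; *-distribʳ-+; *-distribˡ-+; module ≤-Reasoning)
open import Data.Product using (∃; ∃₂; _×_; _,_; proj₁; proj₂)
open import Data.Sum using (_⊎_; inj₁; inj₂; [_,_]′)
import Data.Sum as Sum
open import Function using (_∘_; Injective; Injection)
open import Function.Properties.Inverse using (↔⇒↣)
open import Relation.Nullary using (¬_; ¬?; Dec)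
open import Relation.Nullary.Decidable using (map′; toSum)
open import Relation.Unary using (Pred)
open import Relation.Binary using (IsPartialOrder)
open import Relation.Binary.PropositionalEquality using (_≡_; refl; sym; trans; cong; cong₂; subst; subst₂; setoid)
open import Algebra.Structures using (IsGroup)

pigeonhole-images : ∀ {m n k} {f : Fin m → Fin k} {g : Fin n → Fin k} →
                    Injective _≡_ _≡_ f → Injective _≡_ _≡_ g → k < m + n → ∃₂ λ i j → f i ≡ g j
pigeonhole-images {m} {n} {k} {f} {g} f-inj g-inj k<m+n
  with pigeonhole k<m+n ([ f , g ]′ ∘ splitAt m)
... | p , q , p<q , fg[p]≡fg[q] =
  meet (splitAt m p) (splitAt m q) (<⇒≢ p<q ∘ Injection.injective (↔⇒↣ +↔⊎)) fg[p]≡fg[q]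
  where
  meet : ∀ s t → ¬ s ≡ t → [ f , g ]′ s ≡ [ f , g ]′ t → ∃₂ λ i j → f i ≡ g j
  meet (inj₁ i) (inj₁ i′) i≢i′ fi≡fi′ = ⊥-elim (i≢i′ (cong inj₁ (f-inj fi≡fi′)))
  meet (inj₂ j) (inj₂ j′) j≢j′ gj≡gj′ = ⊥-elim (j≢j′ (cong inj₂ (g-inj gj≡gj′)))
  meet (inj₁ i) (inj₂ j)  _ fi≡gj = i , j , fi≡gj
  meet (inj₂ j) (inj₁ i)  _ gj≡fi = i , j , sym gj≡fi

module _ {a} {A : Set a} where

  Enumerates : ∀ {ℓ} → Pred A ℓ → List A → Set _
  Enumerates P xs = ∀ x → (x ∈ xs → P x) × (P x → x ∈ xs)

  Unique⇒lookup-injective : ∀ {xs : List A} → Unique xs → Injective _≡_ _≡_ (lookup xs)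
  Unique⇒lookup-injective (_ ∷ _) {zero} {zero} _ = refl
  Unique⇒lookup-injective (x∉xs ∷ _) {zero} {suc j} x≡xsⱼ = ⊥-elim (All.lookup x∉xs (∈-lookup j) x≡xsⱼ)
  Unique⇒lookup-injective (x∉xs ∷ _) {suc i} {zero} xsᵢ≡x = ⊥-elim (All.lookup x∉xs (∈-lookup i) (sym xsᵢ≡x))
  Unique⇒lookup-injective (_ ∷ u) {suc i} {suc j} eq = cong suc (Unique⇒lookup-injective u eq)

  Unique-resp-⊆ : ∀ {xs ys : List A} → xs Sublist.⊆ ys → Unique ys → Unique xs
  Unique-resp-⊆ Sublist.[] [] = []
  Unique-resp-⊆ (_ Sublist.∷ʳ τ) (_ ∷ u) = Unique-resp-⊆ τ u
  Unique-resp-⊆ (refl Sublist.∷ τ) (x∉ys ∷ u) = All-resp-⊆ τ x∉ys ∷ Unique-resp-⊆ τ u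

  ∈-Unique-≟ : ∀ {xs : List A} {x y} → Unique xs → x ∈ xs → y ∈ xs → Dec (x ≡ y)
  ∈-Unique-≟ u x∈xs y∈xs =
    map′ (index-injective (setoid A) x∈xs y∈xs) same-index (index x∈xs ≟ᶠ index y∈xs)
    where
    same-index : _ ≡ _ → index x∈xs ≡ index y∈xs
    same-index x≡y =
      Unique⇒lookup-injective u (trans (sym (lookup-index x∈xs)) (trans x≡y (lookup-index y∈xs)))

  pigeonhole-∩ : ∀ {xs ys zs : List A} → Unique xs → Unique ys → xs ⊆ zs → ys ⊆ zs →
                 length zs < length xs + length ys → ∃ λ z → z ∈ xs × z ∈ ys
  pigeonhole-∩ {xs} {ys} {zs} xs! ys! xs⊆zs ys⊆zs |zs|<|xs|+|ys|
    with pigeonhole-images (embedding-injective xs! xs⊆zs) (embedding-injective ys! ys⊆zs) |zs|<|xs|+|ys|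
    where
    embedding : ∀ {ws} → ws ⊆ zs → Fin (length ws) → Fin (length zs)
    embedding ws⊆zs i = index (ws⊆zs (∈-lookup i))
    embedding-injective : ∀ {ws} → Unique ws → (ws⊆zs : ws ⊆ zs) → Injective _≡_ _≡_ (embedding ws⊆zs)
    embedding-injective ws! ws⊆zs = Unique⇒lookup-injective ws! ∘ index-injective (setoid A) _ _
  ... | i , j , same-index = lookup xs i , ∈-lookup i ,
                             subst (_∈ ys) (sym (index-injective (setoid A) _ _ same-index)) (∈-lookup j)

densities-sum>1 : ∀ {n a b d k l} → 0 < n → d < a + b → a * n ≤ d * k → b * n ≤ d * l → n < k + l
densities-sum>1 {n} {a} {b} {d} {k} {l} n>0 d<a+b an≤dk bn≤dl = *-cancelˡ-< d n (k + l) (begin-strict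
  d * n           <⟨ *-monoˡ-< n {{>-nonZero n>0}} d<a+b ⟩
  (a + b) * n     ≡⟨ *-distribʳ-+ n a b ⟩
  a * n + b * n   ≤⟨ +-mono-≤ an≤dk bn≤dl ⟩
  d * k + d * l   ≡⟨ *-distribˡ-+ d k l ⟨
  d * (k + l)     ∎)
  where open ≤-Reasoning

module _ (G : POGroup) where
  open POGroup G
  open IsGroup isGroup using (identityˡ; identityʳ; inverseˡ; inverseʳ)
  open IsPartialOrder isPartialOrder using (antisym) renaming (trans to ≤ᴳ-trans)

  private
    variable
      x y z w : Carrier

  group : Group 0ℓ 0ℓ
  group = record { _≈_ = _≡_ ; _∙_ = _∙_ ; ε = e ; _⁻¹ = _⁻¹ ; isGroup = isGroup }

  open Group group using (_//_)
  open GroupProperties group using (∙-cancelˡ; ∙-cancelʳ; ⁻¹-injective; //-rightDividesˡ)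

  <-trans : x <ᴳ y → y <ᴳ z → x <ᴳ z
  <-trans (x≤y , x≢y) (y≤z , y≢z) = ≤ᴳ-trans x≤y y≤z , λ { refl → x≢y (antisym x≤y y≤z) }

  <-compatˡ : ∀ w → x <ᴳ y → w ∙ x <ᴳ w ∙ y
  <-compatˡ w (x≤y , x≢y) = compatˡ w x≤y , x≢y ∘ ∙-cancelˡ w _ _

  <-compatʳ : ∀ w → x <ᴳ y → x ∙ w <ᴳ y ∙ w
  <-compatʳ w (x≤y , x≢y) = compatʳ w x≤y , x≢y ∘ ∙-cancelʳ w _ _

  x<x∙y : Pos y → x <ᴳ x ∙ y
  x<x∙y {y} {x} y>e = subst (_<ᴳ x ∙ y) (identityʳ x) (<-compatˡ x y>e)

  y<x∙y : Pos x → y <ᴳ x ∙ y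
  y<x∙y {x} {y} x>e = subst (_<ᴳ x ∙ y) (identityˡ y) (<-compatʳ y x>e)

  Pos-∙ : Pos x → Pos y → Pos (x ∙ y)
  Pos-∙ x>e y>e = <-trans x>e (x<x∙y y>e)

  ⁻¹<e : Pos x → x ⁻¹ <ᴳ e
  ⁻¹<e {x} x>e = subst₂ _<ᴳ_ (identityʳ (x ⁻¹)) (inverseˡ x) (<-compatˡ (x ⁻¹) x>e)

  Pos⊎e-∙ : Pos x ⊎ x ≡ e → Pos y ⊎ y ≡ e → Pos (x ∙ y) ⊎ x ∙ y ≡ e
  Pos⊎e-∙ (inj₁ x>e) (inj₁ y>e) = inj₁ (Pos-∙ x>e y>e)
  Pos⊎e-∙ {x} (inj₁ x>e) (inj₂ refl) = inj₁ (subst Pos (sym (identityʳ x)) x>e)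
  Pos⊎e-∙ {y = y} (inj₂ refl) y≥e = subst (λ z → Pos z ⊎ z ≡ e) (sym (identityˡ y)) y≥e

  Prod⊆Pos⊎e : ∀ {A B : Pred Carrier 0ℓ} → (∀ x → A x → Pos x) → (∀ x → B x → Pos x) →
               Prod A B x → Pos x ⊎ x ≡ e
  Prod⊆Pos⊎e A⊆G⁺ B⊆G⁺ (y , z , y∈A∪e , z∈B∪e , refl) =
    Pos⊎e-∙ (Sum.map₁ (A⊆G⁺ y) y∈A∪e) (Sum.map₁ (B⊆G⁺ z) z∈B∪e)

  e∈Prod : ∀ {A B : Pred Carrier 0ℓ} → Prod A B e
  e∈Prod = e , e , inj₂ refl , inj₂ refl , sym (identityˡ e)

  A∪B⊆Prod : ∀ {A B : Pred Carrier 0ℓ} → A x ⊎ B x → Prod A B x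
  A∪B⊆Prod {x} (inj₁ x∈A) = x , e , inj₁ x∈A , inj₂ refl , sym (identityʳ x)
  A∪B⊆Prod {x} (inj₂ x∈B) = e , x , inj₂ refl , inj₁ x∈B , sym (identityˡ x)

  Interval : Carrier → Pred Carrier 0ℓ
  Interval x y = e <ᴳ y × y <ᴳ x

  x//-injective : Injective _≡_ _≡_ (x //_)
  x//-injective {x} = ⁻¹-injective ∘ ∙-cancelˡ x _ _

  Interval-// : Interval x w → Interval x (x // w)
  Interval-// {x} {w} (w>e , w<x) =
    subst (_<ᴳ x ∙ (w ⁻¹)) (inverseʳ w) (<-compatʳ (w ⁻¹) w<x) ,
    subst (x ∙ (w ⁻¹) <ᴳ_) (identityʳ x) (<-compatˡ x (⁻¹<e w>e))

  Split : Pred Carrier 0ℓ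
  Split x = ∃₂ λ y z → Pos y × Pos z × y ∙ z ≡ x

  Split⇒¬Atom : Split x → ¬ Atom x
  Split⇒¬Atom (y , z , y>e , z>e , y∙z≡x) (_ , nothing-below) =
    nothing-below (y , y>e , subst (y <ᴳ_) y∙z≡x (x<x∙y z>e))

  Interval⇒Split : Interval x y → Split x
  Interval⇒Split {x} {y} y∈⦅e,x⦆ =
    x // y , y , proj₁ (Interval-// y∈⦅e,x⦆) , proj₁ y∈⦅e,x⦆ , //-rightDividesˡ y x

  ¬Split⇒Atom : Pos x → ¬ Split x → Atom x
  ¬Split⇒Atom x>e x-unsplit = x>e , λ { (y , y∈⦅e,x⦆) → x-unsplit (Interval⇒Split y∈⦅e,x⦆) }

  map-//-⊆ : ∀ {x} {J ws : List Carrier} → Enumerates (Interval x) J → ws ⊆ J → map (x //_) ws ⊆ J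
  map-//-⊆ {x} J≡⦅e,x⦆ ws⊆J y∈x//ws with ∈-map⁻ (x //_) y∈x//ws
  ... | w , w∈ws , refl = proj₂ (J≡⦅e,x⦆ (x // w)) (Interval-// (proj₁ (J≡⦅e,x⦆ w) (ws⊆J w∈ws)))

  overfull-interval⇒Prod : ∀ {A B : Pred Carrier 0ℓ} {J SA SB : List Carrier} → Unique J →
                           Enumerates (Interval x) J →
                           SA Sublist.⊆ J → SB Sublist.⊆ J → All A SA → All B SB →
                           length J < length SA + length SB → Prod A B x
  overfull-interval⇒Prod {x} {J = J} {SA} {SB} J! J≡⦅e,x⦆ SA⊆J SB⊆J A-SA B-SB |J|<|SA|+|SB|
    with pigeonhole-∩ (Unique-resp-⊆ SA⊆J J!) (Unique.map⁺ x//-injective (Unique-resp-⊆ SB⊆J J!))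
                      (Sublist.lookup SA⊆J) (map-//-⊆ J≡⦅e,x⦆ (Sublist.lookup SB⊆J))
                      (subst (λ n → length J < length SA + n) (sym (length-map (x //_) SB)) |J|<|SA|+|SB|)
  ... | z , z∈SA , z∈x//SB with ∈-map⁻ (x //_) z∈x//SB
  ... | w , w∈SB , refl =
    x // w , w , inj₁ (All.lookup A-SA z∈SA) , inj₁ (All.lookup B-SB w∈SB) , sym (//-rightDividesˡ w x)

  dense-sublist : ∀ {I : Set} {𝒥 : I → List Carrier} {A a d} → σ≥ 𝒥 A a d →
                  ∀ i → ∃ λ S → S Sublist.⊆ 𝒥 i × All A S × a * length (𝒥 i) ≤ d * length S
  dense-sublist {d = d} σ i with σ i
  ... | k , (S , S⊆𝒥ᵢ , A-S , k≤|S|) , a|𝒥ᵢ|≤dk = S , S⊆𝒥ᵢ , A-S , ≤-trans a|𝒥ᵢ|≤dk (*-monoʳ-≤ d k≤|S|)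

  module _ {I : Set} {𝒥 : I → List Carrier} (admissible : Admissible 𝒥) where
    open Admissible admissible

    Pos-≟ : Pos x → Pos y → Dec (x ≡ y)
    Pos-≟ {x} {y} x>e y>e with intervals (x ∙ y) (Pos-∙ x>e y>e) (Split⇒¬Atom (x , y , x>e , y>e , refl))
    ... | i , 𝒥ᵢ≡⦅e,xy⦆ = ∈-Unique-≟ (unique i) (proj₂ (𝒥ᵢ≡⦅e,xy⦆ x) (x>e , x<x∙y y>e))
                                               (proj₂ (𝒥ᵢ≡⦅e,xy⦆ y) (y>e , y<x∙y x>e))

    split? : Pos x → Dec (Split x)
    split? {x} x>e with intervals (x ∙ x) (Pos-∙ x>e x>e) (Split⇒¬Atom (x , x , x>e , x>e , refl))
    ... | i , 𝒥ᵢ≡⦅e,x²⦆ = map′ from-indices to-indices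
                               (any? λ k → any? λ l → Pos-≟ (Pos-∙ (J⁺ k) (J⁺ l)) x>e)
      where
      J : List Carrier
      J = 𝒥 i
      J⁺ : ∀ k → Pos (lookup J k)
      J⁺ k = All.lookup (positive i) (∈-lookup k)
      from-indices : (∃₂ λ k l → lookup J k ∙ lookup J l ≡ x) → Split x
      from-indices (k , l , eq) = lookup J k , lookup J l , J⁺ k , J⁺ l , eq
      below-x⇒∈J : ∀ {y} → Pos y → y <ᴳ x → y ∈ J
      below-x⇒∈J {y} y>e y<x = proj₂ (𝒥ᵢ≡⦅e,x²⦆ y) (y>e , <-trans y<x (x<x∙y x>e))
      to-indices : Split x → ∃₂ λ k l → lookup J k ∙ lookup J l ≡ x
      to-indices (y , z , y>e , z>e , y∙z≡x) =
        index y∈J , index z∈J , trans (sym (cong₂ _∙_ (lookup-index y∈J) (lookup-index z∈J))) y∙z≡x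
        where
        y∈J : y ∈ J
        y∈J = below-x⇒∈J y>e (subst (y <ᴳ_) y∙z≡x (x<x∙y z>e))
        z∈J : z ∈ J
        z∈J = below-x⇒∈J z>e (subst (z <ᴳ_) y∙z≡x (y<x∙y y>e))

    atom? : Pos x → Dec (Atom x)
    atom? x>e =
      map′ (¬Split⇒Atom x>e) (λ x-atom x-splits → Split⇒¬Atom x-splits x-atom) (¬? (split? x>e))

    Prod-of-non-atom : ∀ {A B} → σSumGt1 𝒥 A B → Pos x → ¬ Atom x → Prod A B x
    Prod-of-non-atom {x} {A} {B} (a , b , d , d>0 , d<a+b , σA , σB) x>e x-not-atom
      with intervals x x>e x-not-atom
    ... | i , 𝒥ᵢ≡⦅e,x⦆
      with dense-sublist {A = A} {a} {d} σA i | dense-sublist {A = B} {b} {d} σB i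
    ... | SA , SA⊆𝒥ᵢ , A-SA , a|𝒥ᵢ|≤d|SA| | SB , SB⊆𝒥ᵢ , B-SB , b|𝒥ᵢ|≤d|SB| =
      overfull-interval⇒Prod (unique i) 𝒥ᵢ≡⦅e,x⦆ SA⊆𝒥ᵢ SB⊆𝒥ᵢ A-SA B-SB
        (densities-sum>1 {a = a} {b} {d} (nonempty i) d<a+b a|𝒥ᵢ|≤d|SA| b|𝒥ᵢ|≤d|SB|)

theorem2p3 : (G : POGroup) → let open POGroup G in
    {I : Set} (𝒥 : I → List Carrier) → Admissible 𝒥 →
    (A B : Carrier → Set) →
    (∀ x → A x → Pos x) → (∀ x → B x → Pos x) →
    (∀ x → Atom x → A x ⊎ B x) →
    σSumGt1 𝒥 A B →
    ∀ x → (Prod A B x → Pos x ⊎ x ≡ e) × (Pos x ⊎ x ≡ e → Prod A B x)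
theorem2p3 G 𝒥 admissible A B A⊆G⁺ B⊆G⁺ atoms⊆A∪B σA+σB>1 x = Prod⊆Pos⊎e G A⊆G⁺ B⊆G⁺ , G⁺∪e⊆Prod
  where
  open POGroup G

  G⁺∪e⊆Prod : Pos x ⊎ x ≡ e → Prod A B x
  G⁺∪e⊆Prod (inj₂ refl) = e∈Prod G
  G⁺∪e⊆Prod (inj₁ x>e) =
    [ A∪B⊆Prod G ∘ atoms⊆A∪B x , Prod-of-non-atom G admissible σA+σB>1 x>e ]′
      (toSum (atom? G admissible x>e))
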